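{- Let $K_2$ have vertices $x_0,x_1$. For integers $k\ge0$ define distributions on $K_2$ by $D_{3k}(x_0)=D_{3k}(x_1)=2k$; $D_{3k+1}(x_0)=2k+2$, $D_{3k+1}(x_1)=2k$; $D_{3k+2}(x_0)=2k+2$, $D_{3k+2}(x_1)=2k+1$. Then for every $r\ge1$, $D_r$ is $r$-solvable on $K_2$ and $|D_r|=\lceil 4r/3\rceil\le \frac43 r+\frac23$.
   Context: A distribution on a graph $G=(V,E)$ is a function $D:V\to\mathbb{N}$, with size $|D|=\sum_v D(v)$. A pebbling move removes two pebbles from a vertex having at least two pebbles and places one pebble on a neighbor. A distribution $D$ is $r$-solvable if for every vertex $v$, some sequence of pebbling moves starting from $D$ results in a distribution with at least $r$ pebbles on $v$. -}

module Defs where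

open import Data.Nat using (ℕ; zero; suc; _+_; _*_; _∸_; _≤_; NonZero)
open import Data.Nat.DivMod using (_/_; _%_)
open import Data.Fin using (Fin; zero; suc; _≟_)
open import Data.Product using (Σ; ∃; _×_)
open import Data.List using (sum)
open import Data.Vec.Functional using (foldr)
open import Relation.Binary.PropositionalEquality using (_≡_)
open import Relation.Nullary using (¬_; yes; no)

record Graph : Set₁ where
  field
    n   : ℕ
    Adj : Fin n → Fin n → Set

open Graph public

Distribution : Graph → Set
Distribution G = Fin (n G) → ℕ

size : {G : Graph} → Distribution G → ℕ
size {G} D = foldr _+_ 0 D

move : {G : Graph} → Distribution G → Fin (n G) → Fin (n G) → Distribution G
move D u v w with w ≟ u | w ≟ v
... | yes _ | yes _ = D w ∸ 2 + 1
... | yes _ | no  _ = D w ∸ 2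
... | no  _ | yes _ = D w + 1
... | no  _ | no  _ = D w

data Reachable (G : Graph) : Distribution G → Distribution G → Set where
  done : ∀ {D} → Reachable G D D
  step : ∀ {D D'} (u v : Fin (n G)) → Adj G u v → 2 ≤ D u →
         Reachable G (move {G} D u v) D' → Reachable G D D'

Solvable : (G : Graph) → ℕ → Distribution G → Set
Solvable G r D = ∀ (v : Fin (n G)) → ∃ λ D' → Reachable G D D' × r ≤ D' v

-- The complete graph K₂ on vertices x₀ = zero, x₁ = suc zero.
K₂ : Graph
K₂ = record { n = 2 ; Adj = λ u v → ¬ (u ≡ v) }

pair : ℕ → ℕ → Distribution K₂
pair a b zero       = a
pair a b (suc zero) = b

Dpat : ℕ → ℕ → Distribution K₂
Dpat k 0 = pair (2 * k) (2 * k)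
Dpat k 1 = pair (2 * k + 2) (2 * k)
Dpat k _ = pair (2 * k + 2) (2 * k + 1)

D : ℕ → Distribution K₂
D r = Dpat (r / 3) (r % 3)

⌈_/_⌉ : ℕ → (b : ℕ) → .{{NonZero b}} → ℕ
⌈ a / b ⌉ = (a + b ∸ 1) / b

-- On K₂, moving m pebbles onto one vertex costs 2m pebbles from the other, so pair a b
-- is r-solvable as soon as r ≤ a + ⌊b/2⌋ and r ≤ b + ⌊a/2⌋.
-- Writing r = j + 3k with j < 3, the three shapes of D r satisfy both inequalities and have size
-- ⌈4j/3⌉ + 4k = ⌈4r/3⌉; the bound 3⌈4r/3⌉ ≤ 4r + 2 is an instance of 3⌈x/3⌉ ≤ x + 2.
module Submission where

open import Defs
open import Data.Nat using (ℕ; _+_; _*_; _≤_)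
open import Data.Product using (_×_)
open import Relation.Binary.PropositionalEquality using (_≡_)

open import Data.Nat using (suc; _∸_; _<_; s≤s; z≤n)
open import Data.Nat.Properties hiding (_≟_)
open import Data.Nat.DivMod
open import Data.Nat.Divisibility using (n∣m*n)
open import Data.Nat.Tactic.RingSolver using (solve)
open import Data.Fin using (Fin; zero; suc; _≟_)
open import Data.List using (_∷_; [])
open import Data.Product using (_,_; ∃)
open import Relation.Binary.PropositionalEquality
  using (_≢_; refl; sym; trans; cong; subst; module ≡-Reasoning)
open import Relation.Nullary using (yes; no; contradiction)

module _ {G : Graph} where

  move-source : ∀ (E : Distribution G) {u v} → u ≢ v → move {G} E u v u ≡ E u ∸ 2
  move-source E {u} {v} u≢v with u ≟ u | u ≟ v
  ... | yes _ | yes u≡v = contradiction u≡v u≢v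
  ... | yes _ | no  _   = refl
  ... | no u≢u | _      = contradiction refl u≢u

  move-target : ∀ (E : Distribution G) {u v} → u ≢ v → move {G} E u v v ≡ E v + 1
  move-target E {u} {v} u≢v with v ≟ u | v ≟ v
  ... | yes v≡u | _      = contradiction (sym v≡u) u≢v
  ... | no  _   | yes _  = refl
  ... | no  _   | no v≢v = contradiction refl v≢v

  transfer : ∀ {u v} → Adj G u v → u ≢ v → ∀ m (E : Distribution G) → 2 * m ≤ E u →
             ∃ λ E' → Reachable G E E' × E v + m ≤ E' v
  transfer adj u≢v 0 E _ = E , done , ≤-reflexive (+-identityʳ _)
  transfer {u} {v} adj u≢v (suc m) E 2[1+m]≤Eu =
    let E' , E→E' , moved+m≤E'v = transfer adj u≢v m (move {G} E u v) 2m≤Eu∸2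
    in  E' , step u v adj 2≤Eu E→E' , ≤-trans (≤-reflexive Ev+[1+m]≡moved+m) moved+m≤E'v
    where
    open ≤-Reasoning

    2m+2≤Eu : 2 * m + 2 ≤ E u
    2m+2≤Eu = ≤-trans (≤-reflexive (trans (+-comm (2 * m) 2) (sym (*-suc 2 m)))) 2[1+m]≤Eu

    2≤Eu : 2 ≤ E u
    2≤Eu = ≤-trans (m≤n+m 2 (2 * m)) 2m+2≤Eu

    2m≤Eu∸2 : 2 * m ≤ move {G} E u v u
    2m≤Eu∸2 = begin
      2 * m            ≡⟨ m+n∸n≡m (2 * m) 2 ⟨
      2 * m + 2 ∸ 2    ≤⟨ ∸-monoˡ-≤ 2 2m+2≤Eu ⟩
      E u ∸ 2          ≡⟨ move-source E u≢v ⟨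
      move {G} E u v u ∎

    Ev+[1+m]≡moved+m : E v + suc m ≡ move {G} E u v v + m
    Ev+[1+m]≡moved+m = trans (sym (+-assoc (E v) 1 m)) (cong (_+ m) (sym (move-target E u≢v)))

⌈m/[1+n]⌉≡[m+n]/[1+n] : ∀ m n → ⌈ m / suc n ⌉ ≡ (m + n) / suc n
⌈m/[1+n]⌉≡[m+n]/[1+n] m n = cong (_/ suc n) (+-∸-assoc m (s≤s z≤n))

⌈[m+k*[1+n]]/[1+n]⌉≡⌈m/[1+n]⌉+k : ∀ m k n → ⌈ m + k * suc n / suc n ⌉ ≡ ⌈ m / suc n ⌉ + k
⌈[m+k*[1+n]]/[1+n]⌉≡⌈m/[1+n]⌉+k m k n = begin
  ⌈ m + k * suc n / suc n ⌉              ≡⟨ ⌈m/[1+n]⌉≡[m+n]/[1+n] (m + k * suc n) n ⟩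
  (m + k * suc n + n) / suc n            ≡⟨ cong (_/ suc n) m+k*[1+n]+n≡m+n+k*[1+n] ⟩
  (m + n + k * suc n) / suc n            ≡⟨ +-distrib-/-∣ʳ (m + n) (n∣m*n k) ⟩
  (m + n) / suc n + k * suc n / suc n    ≡⟨ cong ((m + n) / suc n +_) (m*n/n≡m k (suc n)) ⟩
  (m + n) / suc n + k                    ≡⟨ cong (_+ k) (⌈m/[1+n]⌉≡[m+n]/[1+n] m n) ⟨
  ⌈ m / suc n ⌉ + k                      ∎
  where
  open ≡-Reasoning
  m+k*[1+n]+n≡m+n+k*[1+n] : m + k * suc n + n ≡ m + n + k * suc n
  m+k*[1+n]+n≡m+n+k*[1+n] = solve (m ∷ k ∷ n ∷ [])

[1+n]*⌈m/[1+n]⌉≤m+n : ∀ m n → suc n * ⌈ m / suc n ⌉ ≤ m + n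
[1+n]*⌈m/[1+n]⌉≤m+n m n = begin
  suc n * ⌈ m / suc n ⌉          ≡⟨ cong (suc n *_) (⌈m/[1+n]⌉≡[m+n]/[1+n] m n) ⟩
  suc n * ((m + n) / suc n)      ≡⟨ *-comm (suc n) _ ⟩
  (m + n) / suc n * suc n        ≤⟨ m/n*n≤m (m + n) (suc n) ⟩
  m + n                          ∎
  where open ≤-Reasoning

2*m≤n⇒m≤n/2 : ∀ {m n} → 2 * m ≤ n → m ≤ n / 2
2*m≤n⇒m≤n/2 {m} {n} 2m≤n = begin
  m          ≡⟨ m*n/n≡m m 2 ⟨
  m * 2 / 2  ≡⟨ cong (_/ 2) (*-comm m 2) ⟩
  2 * m / 2  ≤⟨ /-monoˡ-≤ 2 2m≤n ⟩
  n / 2      ∎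
  where open ≤-Reasoning

K₂-receive-half : ∀ {u v} → u ≢ v → (E : Distribution K₂) →
                  ∃ λ E' → Reachable K₂ E E' × E v + E u / 2 ≤ E' v
K₂-receive-half {u} u≢v E = transfer {K₂} u≢v u≢v (E u / 2) E 2[Eu/2]≤Eu
  where
  2[Eu/2]≤Eu : 2 * (E u / 2) ≤ E u
  2[Eu/2]≤Eu = ≤-trans (≤-reflexive (*-comm 2 (E u / 2))) (m/n*n≤m (E u) 2)

pair-solvable : ∀ {r} a b → r ≤ a + b / 2 → r ≤ b + a / 2 → Solvable K₂ r (pair a b)
pair-solvable a b r≤a+b/2 _ zero =
  let E' , E→E' , a+b/2≤E'x₀ = K₂-receive-half {suc zero} (λ ()) (pair a b)
  in  E' , E→E' , ≤-trans r≤a+b/2 a+b/2≤E'x₀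
pair-solvable a b _ r≤b+a/2 (suc zero) =
  let E' , E→E' , b+a/2≤E'x₁ = K₂-receive-half {zero} (λ ()) (pair a b)
  in  E' , E→E' , ≤-trans r≤b+a/2 b+a/2≤E'x₁

size-pair : ∀ a b → size {K₂} (pair a b) ≡ a + b
size-pair a b = cong (a +_) (+-identityʳ b)

via-half : ∀ {r a b} m → 2 * m ≤ b → r ≤ a + m → r ≤ a + b / 2
via-half {a = a} m 2m≤b r≤a+m = ≤-trans r≤a+m (+-monoʳ-≤ a (2*m≤n⇒m≤n/2 2m≤b))

module _ (k : ℕ) where

  private
    3k≡2k+k : k * 3 ≡ 2 * k + k
    3k≡2k+k = solve (k ∷ [])

    2+3k≡2k+2+k : 2 + k * 3 ≡ 2 * k + 2 + k
    2+3k≡2k+2+k = solve (k ∷ [])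

    1+3k≡2k+[1+k] : 1 + k * 3 ≡ 2 * k + suc k
    1+3k≡2k+[1+k] = solve (k ∷ [])

    2+3k≡2k+1+[1+k] : 2 + k * 3 ≡ 2 * k + 1 + suc k
    2+3k≡2k+1+[1+k] = solve (k ∷ [])

    2[1+k]≡2k+2 : 2 * suc k ≡ 2 * k + 2
    2[1+k]≡2k+2 = solve (k ∷ [])

  Dpat-solvable : ∀ j → j < 3 → Solvable K₂ (j + k * 3) (Dpat k j)
  Dpat-solvable 0 _ = pair-solvable (2 * k) (2 * k)
    (via-half k ≤-refl (≤-reflexive 3k≡2k+k))
    (via-half k ≤-refl (≤-reflexive 3k≡2k+k))
  Dpat-solvable 1 _ = pair-solvable (2 * k + 2) (2 * k)
    (via-half k ≤-refl (≤-trans (n≤1+n _) (≤-reflexive 2+3k≡2k+2+k)))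
    (via-half (suc k) (≤-reflexive 2[1+k]≡2k+2) (≤-reflexive 1+3k≡2k+[1+k]))
  Dpat-solvable 2 _ = pair-solvable (2 * k + 2) (2 * k + 1)
    (via-half k (m≤m+n (2 * k) 1) (≤-reflexive 2+3k≡2k+2+k))
    (via-half (suc k) (≤-reflexive 2[1+k]≡2k+2) (≤-reflexive 2+3k≡2k+1+[1+k]))
  Dpat-solvable (suc (suc (suc _))) (s≤s (s≤s (s≤s ())))

  size-Dpat : ∀ j → j < 3 → size {K₂} (Dpat k j) ≡ ⌈ 4 * j / 3 ⌉ + 4 * k
  size-Dpat 0 _ = trans (size-pair (2 * k) (2 * k)) (solve (k ∷ []))
  size-Dpat 1 _ = trans (size-pair (2 * k + 2) (2 * k)) (solve (k ∷ []))
  size-Dpat 2 _ = trans (size-pair (2 * k + 2) (2 * k + 1)) (solve (k ∷ []))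
  size-Dpat (suc (suc (suc _))) (s≤s (s≤s (s≤s ())))

proposition6p3 : ∀ (r : ℕ) → 1 ≤ r →
    Solvable K₂ r (D r) × size {K₂} (D r) ≡ ⌈ 4 * r / 3 ⌉ × 3 * ⌈ 4 * r / 3 ⌉ ≤ 4 * r + 2
proposition6p3 r _ = solvable , size≡⌈4r/3⌉ , [1+n]*⌈m/[1+n]⌉≤m+n (4 * r) 2
  where
  open ≡-Reasoning

  j k : ℕ
  j = r % 3
  k = r / 3

  j<3 : j < 3
  j<3 = m%n<n r 3

  r≡j+3k : r ≡ j + k * 3
  r≡j+3k = m≡m%n+[m/n]*n r 3

  solvable : Solvable K₂ r (D r)
  solvable = subst (λ s → Solvable K₂ s (D r)) (sym r≡j+3k) (Dpat-solvable k j j<3)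

  size≡⌈4r/3⌉ : size {K₂} (D r) ≡ ⌈ 4 * r / 3 ⌉
  size≡⌈4r/3⌉ = begin
    size {K₂} (D r)            ≡⟨ size-Dpat k j j<3 ⟩
    ⌈ 4 * j / 3 ⌉ + 4 * k      ≡⟨ ⌈[m+k*[1+n]]/[1+n]⌉≡⌈m/[1+n]⌉+k (4 * j) (4 * k) 2 ⟨
    ⌈ 4 * j + 4 * k * 3 / 3 ⌉  ≡⟨ cong (λ x → ⌈ 4 * j + x / 3 ⌉) (*-assoc 4 k 3) ⟩
    ⌈ 4 * j + 4 * (k * 3) / 3 ⌉ ≡⟨ cong (λ x → ⌈ x / 3 ⌉) (*-distribˡ-+ 4 j (k * 3)) ⟨
    ⌈ 4 * (j + k * 3) / 3 ⌉    ≡⟨ cong (λ s → ⌈ 4 * s / 3 ⌉) r≡j+3k ⟨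
    ⌈ 4 * r / 3 ⌉              ∎
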